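{- Let $\Lambda$ be a numerical semigroup with conductor $c$ and enumeration $\lambda$, and let $g(i)=\lambda_i-i$ for $i\in\mathbb{N}_0$. If $i\in\mathbb{N}_0$ satisfies $g(i)<i$, then $\lambda_i\geq c$.
   Context: A numerical semigroup is a subset $\Lambda\subseteq\mathbb{N}_0$ containing $0$, closed under addition, with finite complement in $\mathbb{N}_0$. The conductor $c$ is the smallest nonnegative integer such that every integer $n\geq c$ belongs to $\Lambda$ (for $\Lambda\neq\mathbb{N}_0$ it is the unique $c\in\Lambda$ with $c-1\notin\Lambda$ and $c+\mathbb{N}_0\subseteq\Lambda$). The enumeration is the unique increasing bijection $\lambda:\mathbb{N}_0\to\Lambda$, $\lambda_i=\lambda(i)$; $g(i)=\lambda_i-i$ is the number of gaps (elements of $\mathbb{N}_0\setminus\Lambda$) smaller than $\lambda_i$. -}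

module Defs where

open import Data.Nat using (ℕ; zero; _+_; _≤_; _<_; _≥_)
open import Data.Product using (Σ; ∃; _×_; _,_)
open import Relation.Binary.PropositionalEquality using (_≡_)
open import Relation.Nullary using (¬_)

record IsNumericalSemigroup (Λ : ℕ → Set) : Set where
  field
    contains-zero : Λ 0
    closed-+      : ∀ {a b} → Λ a → Λ b → Λ (a + b)
    cofinite      : ∃ λ N → ∀ n → N ≤ n → Λ n

record IsConductor (Λ : ℕ → Set) (c : ℕ) : Set where
  field
    above    : ∀ n → c ≤ n → Λ n
    smallest : ∀ d → (∀ n → d ≤ n → Λ n) → c ≤ d

record IsEnumeration (Λ : ℕ → Set) (enum : ℕ → ℕ) : Set where
  field
    in-Λ       : ∀ i → Λ (enum i)
    increasing : ∀ {i j} → i < j → enum i < enum j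
    surjective : ∀ m → Λ m → ∃ λ i → enum i ≡ m

module Submission where

open import Defs
open import Data.Nat using (ℕ; zero; suc; _+_; _∸_; _≤_; _<_; _≥_; z≤n; s≤s; _≟_; _≤?_; _<?_)
open import Data.Nat.Properties
open import Data.Fin using (Fin; fromℕ<; splitAt; join)
open import Data.Fin.Properties using (toℕ<n; toℕ-injective; fromℕ<-injective; injective⇒≤; join-splitAt)
open import Data.Product using (∃; _×_; _,_)
open import Data.Sum using (_⊎_; inj₁; inj₂; [_,_]′)
open import Function using (_∘_)
open import Function.Definitions using (Injective)
open import Relation.Nullary using (¬_; yes; no; contradiction)
open import Relation.Nullary.Decidable using (map′; _→-dec_)
open import Relation.Unary using (Pred; Decidable)
open import Relation.Binary using (tri<; tri≈; tri>)
open import Relation.Binary.PropositionalEquality using (_≡_; _≢_; refl; sym; cong; subst; module ≡-Reasoning)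

-- Suppose λᵢ < c and let h be the least gap above λᵢ. For 1 ≤ j ≤ i, the number h − λⱼ
-- is a gap (adding λⱼ ∈ Λ to it gives h) and lies below λᵢ (everything in [λᵢ, h) is in Λ).
-- These i gaps and the i elements λ₀, …, λᵢ₋₁ are 2i distinct numbers below λᵢ,
-- so i + i ≤ λᵢ, which contradicts λᵢ − i < i.

MapsBelow : ℕ → ℕ → (ℕ → ℕ) → Set
MapsBelow n m f = ∀ {k} → k < n → f k < m

InjectiveBelow : ℕ → (ℕ → ℕ) → Set
InjectiveBelow n f = ∀ {a b} → a < n → b < n → f a ≡ f b → a ≡ b

module _ {p q m : ℕ} {f g : ℕ → ℕ}
         (f<m : MapsBelow p m f) (g<m : MapsBelow q m g)
         (f-inj : InjectiveBelow p f) (g-inj : InjectiveBelow q g)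
         (disjoint : ∀ {a b} → a < p → b < q → f a ≢ g b) where

  private
    f̂ : Fin p → Fin m
    f̂ k = fromℕ< (f<m (toℕ<n k))

    ĝ : Fin q → Fin m
    ĝ k = fromℕ< (g<m (toℕ<n k))

    [f̂,ĝ]-injective : Injective _≡_ _≡_ [ f̂ , ĝ ]′
    [f̂,ĝ]-injective {inj₁ a} {inj₁ b} e =
      cong inj₁ (toℕ-injective (f-inj (toℕ<n a) (toℕ<n b) (fromℕ<-injective _ _ _ _ e)))
    [f̂,ĝ]-injective {inj₁ a} {inj₂ b} e =
      contradiction (fromℕ<-injective _ _ _ _ e) (disjoint (toℕ<n a) (toℕ<n b))
    [f̂,ĝ]-injective {inj₂ a} {inj₁ b} e =
      contradiction (fromℕ<-injective _ _ _ _ (sym e)) (disjoint (toℕ<n b) (toℕ<n a))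
    [f̂,ĝ]-injective {inj₂ a} {inj₂ b} e =
      cong inj₂ (toℕ-injective (g-inj (toℕ<n a) (toℕ<n b) (fromℕ<-injective _ _ _ _ e)))

  disjoint-injections⇒+≤ : p + q ≤ m
  disjoint-injections⇒+≤ = injective⇒≤ {f = [ f̂ , ĝ ]′ ∘ splitAt p} λ {x} {y} e → begin
      x                         ≡⟨ sym (join-splitAt p q x) ⟩
      join p q (splitAt p x)    ≡⟨ cong (join p q) ([f̂,ĝ]-injective {splitAt p x} {splitAt p y} e) ⟩
      join p q (splitAt p y)    ≡⟨ join-splitAt p q y ⟩
      y                         ∎
    where open ≡-Reasoning

least-counterexample : ∀ {ℓ} {P : Pred ℕ ℓ} → Decidable P → ∀ k →
  (∀ {n} → n < k → P n) ⊎ ∃ λ h → h < k × ¬ P h × (∀ {n} → n < h → P n)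
least-counterexample P? zero = inj₁ λ ()
least-counterexample {P = P} P? (suc k) with least-counterexample P? k
... | inj₂ (h , h<k , ¬Ph , P-below) = inj₂ (h , m<n⇒m<1+n h<k , ¬Ph , P-below)
... | inj₁ P-below with P? k
...   | no ¬Pk = inj₂ (k , n<1+n k , ¬Pk , P-below)
...   | yes Pk = inj₁ P-below-suc
  where
  P-below-suc : ∀ {n} → n < suc k → P n
  P-below-suc n<1+k with m<1+n⇒m<n∨m≡n n<1+k
  ... | inj₁ n<k  = P-below n<k
  ... | inj₂ refl = Pk

module Enumeration {Λ : ℕ → Set} {enum : ℕ → ℕ} (E : IsEnumeration Λ enum) where
  open IsEnumeration E

  n≤enum : ∀ n → n ≤ enum n
  n≤enum zero    = z≤n
  n≤enum (suc n) = ≤-<-trans (n≤enum n) (increasing (n<1+n n))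

  enum-mono-≤ : ∀ {a b} → a ≤ b → enum a ≤ enum b
  enum-mono-≤ a≤b with m≤n⇒m<n∨m≡n a≤b
  ... | inj₁ a<b  = <⇒≤ (increasing a<b)
  ... | inj₂ refl = ≤-refl

  enum-injective : ∀ {a b} → enum a ≡ enum b → a ≡ b
  enum-injective {a} {b} e with <-cmp a b
  ... | tri< a<b _ _ = contradiction e (<⇒≢ (increasing a<b))
  ... | tri≈ _ a≡b _ = a≡b
  ... | tri> _ _ b<a = contradiction (sym e) (<⇒≢ (increasing b<a))

  -- Since j ≤ enum j, only indices j ≤ n can enumerate n.
  Λ? : Decidable Λ
  Λ? n = map′ (λ (j , _ , e) → subst Λ e (in-Λ j)) enumerated-early
              (anyUpTo? (λ j → enum j ≟ n) (suc n))
    where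
    enumerated-early : Λ n → ∃ λ j → j < suc n × enum j ≡ n
    enumerated-early Λn with surjective n Λn
    ... | j , e = j , s≤s (subst (j ≤_) e (n≤enum j)) , e

record LeastGapAbove (Λ : ℕ → Set) (m h : ℕ) : Set where
  field
    above  : m < h
    gap    : ¬ Λ h
    filled : ∀ {n} → m ≤ n → n < h → Λ n

module _ {Λ : ℕ → Set} {enum : ℕ → ℕ} (NS : IsNumericalSemigroup Λ) (E : IsEnumeration Λ enum)
         {i h : ℕ} (least-gap : LeastGapAbove Λ (enum i) h) where
  open IsNumericalSemigroup NS
  open IsEnumeration E
  open Enumeration E
  open LeastGapAbove least-gap

  private
    partner : ℕ → ℕ
    partner j = h ∸ enum (suc j)

    enum[1+j]≤h : ∀ {j} → j < i → enum (suc j) ≤ h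
    enum[1+j]≤h j<i = ≤-trans (enum-mono-≤ j<i) (<⇒≤ above)

    partner-gap : ∀ {j} → j < i → ¬ Λ (partner j)
    partner-gap {j} j<i Λp = gap (subst Λ (m∸n+n≡m (enum[1+j]≤h j<i)) (closed-+ Λp (in-Λ (suc j))))

    partner<enum : MapsBelow i (enum i) partner
    partner<enum {j} j<i = ≰⇒> λ enum≤p → partner-gap j<i (filled enum≤p partner<h)
      where
      partner<h : partner j < h
      partner<h = ∸-monoʳ-< (≤-<-trans z≤n (increasing (n<1+n j))) (enum[1+j]≤h j<i)

    partner-injective : InjectiveBelow i partner
    partner-injective a<i b<i e =
      suc-injective (enum-injective (∸-cancelˡ-≡ (enum[1+j]≤h a<i) (enum[1+j]≤h b<i) e))

  least-gap-above-enum⇒i+i≤enum : i + i ≤ enum i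
  least-gap-above-enum⇒i+i≤enum =
    disjoint-injections⇒+≤ increasing partner<enum
      (λ _ _ → enum-injective) partner-injective
      (λ {a} _ b<i e → partner-gap b<i (subst Λ e (in-Λ a)))

below-conductor⇒least-gap-above : ∀ {Λ c enum} → IsConductor Λ c → IsEnumeration Λ enum →
  ∀ {m} → Λ m → m < c → ∃ (LeastGapAbove Λ m)
below-conductor⇒least-gap-above {Λ} {c} C E {m} Λm m<c
  with least-counterexample (λ n → m ≤? n →-dec Enumeration.Λ? E n) c
... | inj₁ filled-below-c = contradiction (smallest m filled-from-m) (<⇒≱ m<c)
  where
  open IsConductor C
  filled-from-m : ∀ n → m ≤ n → Λ n
  filled-from-m n m≤n with n <? c
  ... | yes n<c = filled-below-c n<c m≤n
  ... | no n≮c  = above n (≮⇒≥ n≮c)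
... | inj₂ (h , _ , failure , filled-below-h) = h , record
  { above  = ≤∧≢⇒< m≤h λ { refl → ¬Λh Λm }
  ; gap    = ¬Λh
  ; filled = λ m≤n n<h → filled-below-h n<h m≤n
  }
  where
  m≤h : m ≤ h
  m≤h = ≮⇒≥ λ h<m → failure λ m≤h → contradiction m≤h (<⇒≱ h<m)
  ¬Λh : ¬ Λ h
  ¬Λh Λh = failure λ _ → Λh

mainTheorem5 : (Λ : ℕ → Set) → IsNumericalSemigroup Λ →
    (c : ℕ) → IsConductor Λ c →
    (enum : ℕ → ℕ) → IsEnumeration Λ enum →
    (i : ℕ) → (enum i ∸ i) < i → enum i ≥ c
mainTheorem5 Λ NS c C enum E i enum∸i<i with c ≤? enum i
... | yes c≤enum = c≤enum
... | no c≰enum with below-conductor⇒least-gap-above C E (IsEnumeration.in-Λ E i) (≰⇒> c≰enum)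
...   | h , least-gap =
  contradiction (m+n≤o⇒m≤o∸n i (least-gap-above-enum⇒i+i≤enum NS E least-gap)) (<⇒≱ enum∸i<i)
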